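{- Let $\mathcal A$ be a connected graph search, let $G$ be a finite, simple, undirected, connected graph and let $T$ be a spanning tree of $G$ rooted in $r$. Let $\pi$ be the reflexive and transitive closure of the relation $\mathcal{R}:=\{(x,y)\mid x \text{ is the parent of } y \text{ in } T, \text{ or there is a child } z \text{ of } x \text{ in } T \text{ with } yz\in E(G)\}$. Then for every $\mathcal A$-ordering $\sigma$ of $G$: $T$ is the $\mathcal F$-tree of $\sigma$ if and only if $\pi$ is a partial order and $\sigma$ is a linear extension of $\pi$.
   Context: A vertex ordering $\sigma$ of $G$ is a bijection $\{1,\dots,|V(G)|\}\to V(G)$, with $u\prec_\sigma v$ iff $\sigma^{ -1}(u)<\sigma^{ -1}(v)$. A graph search is an algorithm that outputs vertex orderings of the input graph; an $\mathcal A$-ordering is a possible output of $\mathcal A$. A graph search is connected if each of its orderings is a Generic Search ordering, i.e. every vertex other than the first has a neighbor to its left. The $\mathcal F$-tree of such an ordering $\sigma$ is the spanning tree, rooted at the first vertex of $\sigma$, in which every vertex other than the first is joined to its leftmost neighbor in $\sigma$. A linear extension of a partial order $\pi$ is a total order $\sigma$ such that $x\prec_\pi y$ (i.e. $(x,y)\in\pi$, $x\neq y$) implies $x\prec_\sigma y$. -}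

module Defs where

open import Data.Nat using (ℕ; zero; suc)
open import Data.Fin using (Fin; toℕ) renaming (_<_ to _<ᶠ_)
open import Data.Bool using (Bool; T)
open import Data.Product using (Σ; ∃; _×_; ∃-syntax)
open import Data.Sum using (_⊎_)
open import Relation.Nullary using (¬_)
open import Relation.Binary.PropositionalEquality using (_≡_; _≢_)
open import Relation.Binary.Construct.Closure.ReflexiveTransitive using (Star)
open import Function.Bundles using (_↔_; Inverse)

record Graph (n : ℕ) : Set where
  field
    adj   : Fin n → Fin n → Bool
    sym   : ∀ u v → adj u v ≡ adj v u
    irrefl : ∀ v → ¬ T (adj v v)

Edge : ∀ {n} → Graph n → Fin n → Fin n → Set
Edge G u v = T (Graph.adj G u v)

Connected : ∀ {n} → Graph n → Set
Connected G = ∀ u v → Star (Edge G) u v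

-- A vertex ordering: a bijection {positions} → V(G).
-- Inverse.to σ : position ↦ vertex ; Inverse.from σ : vertex ↦ position (σ⁻¹).
Ordering : ℕ → Set
Ordering n = Fin n ↔ Fin n

_≺[_]_ : ∀ {n} → Fin n → Ordering n → Fin n → Set
u ≺[ σ ] v = Inverse.from σ u <ᶠ Inverse.from σ v

IsFirst : ∀ {n} → Ordering n → Fin n → Set
IsFirst σ v = toℕ (Inverse.from σ v) ≡ 0

IsGenericSearchOrdering : ∀ {n} → Graph n → Ordering n → Set
IsGenericSearchOrdering G σ =
  ∀ v → ¬ IsFirst σ v → ∃[ u ] (Edge G u v × u ≺[ σ ] v)

-- A graph search is described by its set of possible outputs (its orderings) on each graph.
GraphSearch : Set₁
GraphSearch = ∀ {n} → Graph n → Ordering n → Set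

IsConnectedSearch : GraphSearch → Set
IsConnectedSearch 𝒜 = ∀ {n} (G : Graph n) (σ : Ordering n) → 𝒜 G σ → IsGenericSearchOrdering G σ

iter : ∀ {A : Set} → (A → A) → ℕ → A → A
iter f zero x = x
iter f (suc k) x = f (iter f k x)

-- A spanning tree of G rooted in r, represented by its parent map:
-- every non-root vertex v is joined in G to its parent, and following
-- parents from any vertex eventually reaches the root r.
-- (The value of parent at r is irrelevant.)
record RootedSpanningTree {n} (G : Graph n) (r : Fin n) : Set where
  field
    parent      : Fin n → Fin n
    parent-edge : ∀ v → v ≢ r → Edge G (parent v) v
    reaches-root : ∀ v → ∃[ k ] (iter parent k v ≡ r)

IsParent : ∀ {n} {G : Graph n} {r : Fin n} → RootedSpanningTree G r → Fin n → Fin n → Set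
IsParent {r = r} T x y = y ≢ r × RootedSpanningTree.parent T y ≡ x

ℛ : ∀ {n} {G : Graph n} {r : Fin n} → RootedSpanningTree G r → Fin n → Fin n → Set
ℛ {G = G} T x y = IsParent T x y ⊎ ∃[ z ] (IsParent T x z × Edge G y z)

π : ∀ {n} {G : Graph n} {r : Fin n} → RootedSpanningTree G r → Fin n → Fin n → Set
π T = Star (ℛ T)

-- π is a partial order (reflexivity and transitivity hold by construction;
-- the remaining requirement is antisymmetry).
IsPartialOrder : ∀ {n} → (Fin n → Fin n → Set) → Set
IsPartialOrder P = ∀ x y → P x y → P y x → x ≡ y

IsLinearExtension : ∀ {n} → Ordering n → (Fin n → Fin n → Set) → Set
IsLinearExtension σ P = ∀ x y → P x y → x ≢ y → x ≺[ σ ] y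

IsLeftmostNeighbour : ∀ {n} → Graph n → Ordering n → Fin n → Fin n → Set
IsLeftmostNeighbour G σ u v = Edge G u v × (∀ w → Edge G w v → ¬ (w ≺[ σ ] u))

IsFTree : ∀ {n} {G : Graph n} {r : Fin n} → RootedSpanningTree G r → Ordering n → Set
IsFTree {G = G} {r = r} T σ =
  IsFirst σ r × (∀ v → v ≢ r → IsLeftmostNeighbour G σ (RootedSpanningTree.parent T v) v)

-- If T is the F-tree of σ, every R-step x R y has x weakly left of y in σ: the parent of y is its
-- leftmost neighbour, and y, being a neighbour of a child z of x, is not left of x = parent z.
-- So π embeds into the position order, which makes it antisymmetric and σ a linear extension.
-- Conversely, the root is π-below every vertex (follow parents up), so a linear extension starts
-- at r; and a neighbour w of v left of parent v would give parent v R w, contradicting σ.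
module Submission where

open import Defs
open import Data.Fin using (Fin; toℕ; _≟_) renaming (zero to fzero)
open import Data.Fin.Properties using (toℕ-injective)
open import Data.Nat using (ℕ; zero; suc; _≤_; _<_)
open import Data.Nat.Properties
  using (≤-refl; ≤-trans; ≤-antisym; <⇒≤; ≤-<-trans; ≮⇒≥; ≤∧≢⇒<; <-irrefl; <-asym; n≮0)
open import Data.Product using (_×_; _,_; proj₁; proj₂)
open import Data.Sum using (inj₁; inj₂)
open import Relation.Nullary using (¬_; yes; no; contradiction)
open import Relation.Binary.PropositionalEquality
open import Relation.Binary.Construct.Closure.ReflexiveTransitive using (Star; ε; _◅_; _◅◅_; fold)
open import Function using (_∘_)
open import Function.Bundles using (_⇔_; mk⇔; Inverse; Injection)
open import Function.Properties.Inverse using (↔-sym; Inverse⇒Injection)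

module _ {n} (σ : Ordering n) where

  position : Fin n → ℕ
  position x = toℕ (Inverse.from σ x)

  position-injective : ∀ {x y} → position x ≡ position y → x ≡ y
  position-injective = Injection.injective (Inverse⇒Injection (↔-sym σ)) ∘ toℕ-injective

  IsFirst-unique : ∀ {x y} → IsFirst σ x → IsFirst σ y → x ≡ y
  IsFirst-unique x-first y-first = position-injective (trans x-first (sym y-first))

  module _ {P : Fin n → Fin n → Set} (P-monotone : ∀ {x y} → P x y → position x ≤ position y) where

    Star-monotone : ∀ {x y} → Star P x y → position x ≤ position y
    Star-monotone = fold (λ x y → position x ≤ position y) (λ p → ≤-trans (P-monotone p)) ≤-refl

    monotone⇒IsPartialOrder : IsPartialOrder (Star P)
    monotone⇒IsPartialOrder x y p q = position-injective (≤-antisym (Star-monotone p) (Star-monotone q))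

    monotone⇒IsLinearExtension : IsLinearExtension σ (Star P)
    monotone⇒IsLinearExtension x y p x≢y =
      ≤∧≢⇒< (Star-monotone p) (x≢y ∘ position-injective)

precedes-all⇒IsFirst : ∀ {n} (σ : Ordering n) r → (∀ v → r ≢ v → r ≺[ σ ] v) → IsFirst σ r
precedes-all⇒IsFirst {suc _} σ r r≺ with r ≟ Inverse.to σ fzero
... | yes refl = cong toℕ (Inverse.strictlyInverseʳ σ fzero)
... | no r≢first =
  contradiction (subst (λ i → position σ r < toℕ i) (Inverse.strictlyInverseʳ σ fzero) (r≺ _ r≢first)) n≮0

module _ {n} {G : Graph n} {r : Fin n} (T : RootedSpanningTree G r) where
  open RootedSpanningTree T

  iter-parent-suc : ∀ k v → iter parent (suc k) v ≡ iter parent k (parent v)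
  iter-parent-suc zero    v = refl
  iter-parent-suc (suc k) v = cong parent (iter-parent-suc k v)

  iter-parent≡root⇒π : ∀ k v → iter parent k v ≡ r → π T r v
  iter-parent≡root⇒π zero v refl = ε
  iter-parent≡root⇒π (suc k) v eq with v ≟ r
  ... | yes refl = ε
  ... | no v≢r = iter-parent≡root⇒π k (parent v) (trans (sym (iter-parent-suc k v)) eq)
                   ◅◅ (inj₁ (v≢r , refl) ◅ ε)

  root-π-least : ∀ v → π T r v
  root-π-least v = iter-parent≡root⇒π (proj₁ (reaches-root v)) v (proj₂ (reaches-root v))

  module _ (σ : Ordering n) where

    IsFTree⇒ℛ-monotone : IsGenericSearchOrdering G σ → IsFTree T σ →
                         ∀ {x y} → ℛ T x y → position σ x ≤ position σ y
    IsFTree⇒ℛ-monotone search (r-first , leftmost) (inj₁ (y≢r , refl)) =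
      let (u , u~y , u≺y) = search _ (λ y-first → y≢r (IsFirst-unique σ y-first r-first))
      in <⇒≤ (≤-<-trans (≮⇒≥ (proj₂ (leftmost _ y≢r) u u~y)) u≺y)
    IsFTree⇒ℛ-monotone _ (_ , leftmost) (inj₂ (z , (z≢r , refl) , y~z)) =
      ≮⇒≥ (proj₂ (leftmost z z≢r) _ y~z)

    IsLinearExtension⇒IsFTree : IsLinearExtension σ (π T) → IsFTree T σ
    IsLinearExtension⇒IsFTree linear =
      precedes-all⇒IsFirst σ r (λ v r≢v → linear r v (root-π-least v) r≢v) , leftmost
      where
      leftmost : ∀ v → v ≢ r → IsLeftmostNeighbour G σ (parent v) v
      leftmost v v≢r = parent-edge v v≢r , not-left
        where
        not-left : ∀ w → Edge G w v → ¬ (w ≺[ σ ] parent v)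
        not-left w w~v w≺p with parent v ≟ w
        ... | yes refl = <-irrefl refl w≺p
        ... | no p≢w = <-asym w≺p (linear (parent v) w (inj₂ (v , (v≢r , refl) , w~v) ◅ ε) p≢w)

proposition1 : (𝒜 : GraphSearch) → IsConnectedSearch 𝒜 →
    ∀ {n} (G : Graph n) → Connected G →
    (r : Fin n) (T : RootedSpanningTree G r) →
    (σ : Ordering n) → 𝒜 G σ →
    IsFTree T σ ⇔ (IsPartialOrder (π T) × IsLinearExtension σ (π T))
proposition1 𝒜 connected G _ r T σ σ∈𝒜 = mk⇔
  (λ F → let monotone = IsFTree⇒ℛ-monotone T σ (connected G σ σ∈𝒜) F
         in monotone⇒IsPartialOrder σ monotone , monotone⇒IsLinearExtension σ monotone)
  (λ (_ , linear) → IsLinearExtension⇒IsFTree T σ linear)
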